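{- Let $G$ be a graph of order $n\ge 3$ which is either a perfect matching (i.e. $n$ is even and $G$ consists of $n/2$ pairwise disjoint edges) or an almost perfect matching (i.e. $n$ is odd and $G$ consists of $(n-1)/2$ pairwise disjoint edges together with one isolated vertex). Then \[2\,\nu(F_2(G))=\binom{n}{2}-\lfloor n/2\rfloor.\]
   Context: For a simple finite graph $G$, the $2$-token graph $F_2(G)$ is the graph whose vertices are all $2$-element subsets of $V(G)$, two such subsets being adjacent iff their symmetric difference is an edge of $G$. $\nu(H)$ denotes the matching number of a graph $H$. -}

module Defs where

open import Data.Nat using (ℕ; _≤_)
open import Data.Fin using (Fin; _<_)
open import Data.Product using (Σ; _×_; _,_; ∃; ∃-syntax; proj₁)
open import Data.Sum using (_⊎_; inj₁; inj₂)
open import Data.List using (List; length; concatMap; _∷_; [])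
open import Data.List.Relation.Unary.All using (All)
open import Data.List.Relation.Unary.Unique.Propositional using (Unique)
open import Relation.Nullary using (¬_)
open import Relation.Binary.PropositionalEquality using (_≡_)
open import Function.Bundles using (_⇔_; mk⇔; Equivalence)
open import Data.Empty using (⊥-elim)
open import Data.Nat using (_*_; _∸_; _/_)
open import Data.Nat.Combinatorics using (_C_)

record Graph (V : Set) : Set₁ where
  field
    Adj   : V → V → Set
    sym   : ∀ {u v} → Adj u v → Adj v u
    irrefl : ∀ {u} → ¬ Adj u u
open Graph public

endpoints : {V : Set} → List (V × V) → List V
endpoints = concatMap (λ { (u , v) → u ∷ v ∷ [] })

IsMatching : {V : Set} → Graph V → List (V × V) → Set
IsMatching G M = All (λ { (u , v) → Adj G u v }) M × Unique (endpoints M)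

IsMatchingNumber : {V : Set} → Graph V → ℕ → Set
IsMatchingNumber G k =
  (Σ (List _) λ M → IsMatching G M × length M ≡ k) ×
  (∀ M → IsMatching G M → length M ≤ k)

-- 2-element subsets of Fin n, represented as pairs (a , b) with a < b.
Pair2 : ℕ → Set
Pair2 n = Σ (Fin n × Fin n) λ { (a , b) → a < b }

_∈₂_ : {n : ℕ} → Fin n → Pair2 n → Set
x ∈₂ ((a , b) , _) = x ≡ a ⊎ x ≡ b

_∈△_,_ : {n : ℕ} → Fin n → Pair2 n → Pair2 n → Set
x ∈△ A , B = (x ∈₂ A × ¬ (x ∈₂ B)) ⊎ (x ∈₂ B × ¬ (x ∈₂ A))

TokenAdj : {n : ℕ} → Graph (Fin n) → Pair2 n → Pair2 n → Set
TokenAdj G A B = ∃[ u ] ∃[ v ] (Adj G u v × (∀ x → (x ∈△ A , B) ⇔ (x ≡ u ⊎ x ≡ v)))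

private
  △-swap : {n : ℕ} {x : Fin n} {A B : Pair2 n} → x ∈△ A , B → x ∈△ B , A
  △-swap (inj₁ p) = inj₂ p
  △-swap (inj₂ p) = inj₁ p

  tok-sym : {n : ℕ} (G : Graph (Fin n)) {A B : Pair2 n} → TokenAdj G A B → TokenAdj G B A
  tok-sym G {A} {B} (u , v , e , f) = u , v , e , λ x →
    mk⇔ (λ h → Equivalence.to (f x) (△-swap {A = B} {B = A} h)) (λ h → △-swap {A = A} {B = B} (Equivalence.from (f x) h))

  △-self : {n : ℕ} {x : Fin n} {A : Pair2 n} → ¬ (x ∈△ A , A)
  △-self (inj₁ (p , q)) = q p
  △-self (inj₂ (p , q)) = q p

  tok-irr : {n : ℕ} (G : Graph (Fin n)) {A : Pair2 n} → ¬ TokenAdj G A A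
  tok-irr G {A} (u , v , e , f) = △-self {A = A} (Equivalence.from (f u) (inj₁ _≡_.refl))

F₂ : {n : ℕ} → Graph (Fin n) → Graph (Pair2 n)
F₂ G = record { Adj = TokenAdj G ; sym = λ {A} {B} → tok-sym G {A} {B} ; irrefl = λ {A} → tok-irr G {A} }

HasUniqueNeighbour : {V : Set} → Graph V → V → Set
HasUniqueNeighbour G v = ∃[ u ] (Adj G v u × (∀ w → Adj G v w → w ≡ u))

-- G is a perfect matching: n even and G consists of n/2 pairwise disjoint edges
-- (equivalently every vertex lies on exactly one edge).
IsPerfectMatchingGraph : {n : ℕ} → Graph (Fin n) → Set
IsPerfectMatchingGraph {n} G = (∃[ m ] n ≡ 2 * m) × (∀ v → HasUniqueNeighbour G v)

IsAlmostPerfectMatchingGraph : {n : ℕ} → Graph (Fin n) → Set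
IsAlmostPerfectMatchingGraph {n} G =
  (∃[ m ] n ≡ Data.Nat.suc (2 * m)) ×
  (∃[ w ] ((∀ u → ¬ Adj G w u) × (∀ v → ¬ v ≡ w → HasUniqueNeighbour G v)))

-- Write x̄ for the mate of x in G, with x̄ = x for the isolated vertex of an almost perfect
-- matching. A 2-set {a, ā} is an isolated vertex of F₂(G): a move along an edge u ū of G
-- swaps u for ū, and a set closed under the bar cannot lose or gain just one of them.
-- Every other 2-set {x, y} meets two different classes {x, x̄}, {y, ȳ}; moving the token
-- of the class with the smaller key min(x, x̄) to its mate is an involution σ without fixed
-- points on these 2-sets (the classes, hence the keys, are unchanged) such that A ~ σ A.
-- So the C(n,2) − ⌊n/2⌋ non-edge 2-sets carry a perfect matching {A, σ A} of F₂(G), while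
-- no matching can use the isolated 2-sets: ν(F₂(G)) is half their number.

module Submission where

open import Level using (0ℓ)
open import Data.Empty using (⊥; ⊥-elim)
open import Data.Product using (Σ; _,_; _×_; proj₁; proj₂)
open import Data.Sum using (_⊎_; inj₁; inj₂; [_,_]′; swap)
open import Data.Nat using (ℕ; zero; suc; _+_; _*_; _∸_; _/_; _⊓_; _≤_; _<_; _<?_; z≤n; s≤s)
import Data.Nat.Properties as ℕ
open import Data.Nat.DivMod using (+-distrib-/-∣ʳ; m<n⇒m/n≡0; /-congˡ; m*n/n≡m)
open import Data.Nat.Divisibility using (divides)
open import Data.Nat.Combinatorics using (_C_; nC1≡n; nCk+nC[k+1]≡[n+1]C[k+1])
open import Data.Fin as Fin using (Fin; toℕ)
import Data.Fin.Properties as Fin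
open import Data.List using (List; []; _∷_; _++_; [_]; length; map; filter; allFin)
open import Data.List.Properties using (length-++; length-++-sucʳ; length-map; length-tabulate)
open import Data.List.Membership.Propositional using (_∈_)
open import Data.List.Membership.Propositional.Properties
  using (∈-∃++; ∈-++⁻; ∈-++⁺ˡ; ∈-++⁺ʳ; ∈-map⁺; ∈-map⁻; ∈-filter⁺; ∈-filter⁻; ∈-allFin)
open import Data.List.Membership.Setoid.Properties using (index-injective)
open import Data.List.Relation.Binary.Subset.Propositional using (_⊆_)
open import Data.List.Relation.Binary.Permutation.Propositional using (_↭_; prep; ↭-refl; ↭-sym; ↭-trans; ↭⇒↭ₛ)
open import Data.List.Relation.Binary.Permutation.Propositional.Properties using (shift)
import Data.List.Relation.Binary.Permutation.Setoid.Properties as ↭ₛ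
import Data.List.Relation.Unary.Any as Any
open import Data.List.Relation.Unary.Any using (here; there)
open import Data.List.Relation.Unary.All as All using (All; _∷_)
import Data.List.Relation.Unary.All.Properties as All
open import Data.List.Relation.Unary.Unique.Propositional using (Unique; []; _∷_)
import Data.List.Relation.Unary.Unique.Propositional.Properties as Unique
open import Function using (_∘_; id; case_of_)
open import Function.Bundles using (_⇔_; mk⇔; Equivalence)
open import Function.Construct.Identity using (⇔-id)
open import Function.Construct.Symmetry using (⇔-sym)
open import Function.Construct.Composition using (_⇔-∘_)
open import Relation.Nullary using (¬_; Dec; yes; no)
open import Relation.Nullary.Decidable using (_⊎-dec_)
open import Relation.Unary using (Pred; Decidable)
open import Relation.Unary.Properties using (∁?)
open import Relation.Binary.Definitions using (tri<; tri≈; tri>)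
open import Relation.Binary.PropositionalEquality
  using (_≡_; _≢_; refl; sym; trans; cong; cong₂; subst; setoid; module ≡-Reasoning)

open import Defs hiding (sym)

module _ {a} {A : Set a} where

  ∈-++-∷-≢ : ∀ {x z : A} xs {ys} → z ∈ xs ++ x ∷ ys → z ≢ x → z ∈ xs ++ ys
  ∈-++-∷-≢ xs z∈ z≢x with ∈-++⁻ xs z∈
  ... | inj₁ z∈xs = ∈-++⁺ˡ z∈xs
  ... | inj₂ (here z≡x) = ⊥-elim (z≢x z≡x)
  ... | inj₂ (there z∈ys) = ∈-++⁺ʳ xs z∈ys

  Unique-⊆⇒length-≤ : ∀ {xs ys : List A} → Unique xs → xs ⊆ ys → length xs ≤ length ys
  Unique-⊆⇒length-≤ {[]} _ _ = z≤n
  Unique-⊆⇒length-≤ {x ∷ xs} (x≢xs ∷ xs!) xs⊆ys with ∈-∃++ (xs⊆ys (here refl))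
  ... | ys₁ , ys₂ , refl = ℕ.≤-trans (s≤s (Unique-⊆⇒length-≤ xs! xs⊆ys₁++ys₂))
                                     (ℕ.≤-reflexive (sym (length-++-sucʳ ys₁ x ys₂)))
    where
    xs⊆ys₁++ys₂ : xs ⊆ ys₁ ++ ys₂
    xs⊆ys₁++ys₂ z∈xs = ∈-++-∷-≢ ys₁ (xs⊆ys (there z∈xs)) (λ z≡x → All.lookup x≢xs z∈xs (sym z≡x))

  Unique-allEqual⇒length≤1 : ∀ {xs : List A} → Unique xs → (∀ {x y} → x ∈ xs → y ∈ xs → x ≡ y) →
                             length xs ≤ 1
  Unique-allEqual⇒length≤1 {[]} _ _ = z≤n
  Unique-allEqual⇒length≤1 {x ∷ _} xs! all-equal =
    Unique-⊆⇒length-≤ {ys = [ x ]} xs! (λ y∈ → here (all-equal y∈ (here refl)))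

  length-filter-∁ : ∀ {p} {P : Pred A p} (P? : Decidable P) xs →
                    length (filter P? xs) + length (filter (∁? P?) xs) ≡ length xs
  length-filter-∁ P? [] = refl
  length-filter-∁ P? (x ∷ xs) with P? x
  ... | yes _ = cong suc (length-filter-∁ P? xs)
  ... | no _ = trans (ℕ.+-suc _ _) (cong suc (length-filter-∁ P? xs))

  Unique-resp-↭ : ∀ {xs ys : List A} → xs ↭ ys → Unique xs → Unique ys
  Unique-resp-↭ xs↭ys = ↭ₛ.Unique-resp-↭ (setoid A) (↭⇒↭ₛ xs↭ys)

module _ {a b} {A : Set a} {B : Set b} where

  Unique-map⁺-on : (f : A → B) {xs : List A} → (∀ {x y} → x ∈ xs → y ∈ xs → f x ≡ f y → x ≡ y) →
                   Unique xs → Unique (map f xs)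
  Unique-map⁺-on f _ [] = []
  Unique-map⁺-on f {x ∷ xs} f-inj (x≢xs ∷ xs!) =
    All.tabulate x≢image ∷ Unique-map⁺-on f (λ x∈ y∈ → f-inj (there x∈) (there y∈)) xs!
    where
    x≢image : ∀ {z} → z ∈ map f xs → f x ≢ z
    x≢image fy∈ fx≡fy with ∈-map⁻ f fy∈
    ... | y , y∈xs , refl = All.lookup x≢xs y∈xs (f-inj (here refl) (there y∈xs) fx≡fy)

  length-≤-by-injection : (f : A → B) {xs : List A} {ys : List B} → Unique xs →
                          (∀ {x y} → x ∈ xs → y ∈ xs → f x ≡ f y → x ≡ y) →
                          (∀ {x} → x ∈ xs → f x ∈ ys) → length xs ≤ length ys
  length-≤-by-injection f {xs} {ys} xs! f-inj f-into =
    subst (_≤ length ys) (length-map f xs) (Unique-⊆⇒length-≤ (Unique-map⁺-on f f-inj xs!) image⊆ys)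
    where
    image⊆ys : map f xs ⊆ ys
    image⊆ys fx∈ with ∈-map⁻ f fx∈
    ... | x , x∈xs , refl = f-into x∈xs

module _ {A : Set} where

  length-endpoints : (M : List (A × A)) → length (endpoints M) ≡ 2 * length M
  length-endpoints [] = refl
  length-endpoints (_ ∷ M) = trans (cong (suc ∘ suc) (length-endpoints M)) (sym (ℕ.*-suc 2 (length M)))

  endpoints-map-graph : (f : A → A) (xs : List A) → endpoints (map (λ x → x , f x) xs) ↭ xs ++ map f xs
  endpoints-map-graph f [] = ↭-refl
  endpoints-map-graph f (x ∷ xs) =
    prep x (↭-trans (prep (f x) (endpoints-map-graph f xs)) (↭-sym (shift (f x) xs (map f xs))))

[f+2k]/2≡k : ∀ f k → f ≤ 1 → (f + 2 * k) / 2 ≡ k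
[f+2k]/2≡k f k f≤1 = begin
  (f + 2 * k) / 2     ≡⟨ +-distrib-/-∣ʳ f (divides k (ℕ.*-comm 2 k)) ⟩
  f / 2 + 2 * k / 2   ≡⟨ cong₂ _+_ (m<n⇒m/n≡0 (s≤s f≤1)) (trans (/-congˡ (ℕ.*-comm 2 k)) (m*n/n≡m k 2)) ⟩
  k                   ∎
  where open ≡-Reasoning

module _ {V : Set} {L : List V} (L-complete : ∀ A → A ∈ L) where

  position : V → ℕ
  position A = toℕ (Any.index (L-complete A))

  position-injective : ∀ {A B} → position A ≡ position B → A ≡ B
  position-injective {A} {B} eq =
    index-injective (setoid V) (L-complete A) (L-complete B) (Fin.toℕ-injective eq)

-- The rank only serves to single out one point of each orbit {A , σ A}.
module InvolutionOrbits
  {V : Set} {L : List V} (L-unique : Unique L) (L-complete : ∀ A → A ∈ L)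
  (rank : V → ℕ) (rank-injective : ∀ {A B} → rank A ≡ rank B → A ≡ B)
  (σ : V → V) (σ-involutive : ∀ A → σ (σ A) ≡ A)
  {P : Pred V 0ℓ} (P? : Decidable P) (P-σ : ∀ {A} → P A → P (σ A)) (P⇒σ-moves : ∀ {A} → P A → σ A ≢ A)
  where

  σ-injective : ∀ {A B} → σ A ≡ σ B → A ≡ B
  σ-injective {A} {B} eq = trans (sym (σ-involutive A)) (trans (cong σ eq) (σ-involutive B))

  Ascending : Pred V 0ℓ
  Ascending A = rank A < rank (σ A)

  ascending? : Decidable Ascending
  ascending? A = rank A <? rank (σ A)

  moved ascending descending : List V
  moved = filter P? L
  ascending = filter ascending? moved
  descending = filter (∁? ascending?) moved

  moved! : Unique moved
  moved! = Unique.filter⁺ P? L-unique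

  moved⇒P : ∀ {A} → A ∈ moved → P A
  moved⇒P A∈ = proj₂ (∈-filter⁻ P? {xs = L} A∈)

  moved-σ : ∀ {A} → A ∈ moved → σ A ∈ moved
  moved-σ A∈ = ∈-filter⁺ P? (L-complete _) (P-σ (moved⇒P A∈))

  ascending⇒¬ascending-σ : ∀ {A} → Ascending A → ¬ Ascending (σ A)
  ascending⇒¬ascending-σ {A} asc asc-σ =
    ℕ.<-asym asc (subst (λ B → rank (σ A) < rank B) (σ-involutive A) asc-σ)

  ¬ascending⇒ascending-σ : ∀ {A} → P A → ¬ Ascending A → Ascending (σ A)
  ¬ascending⇒ascending-σ {A} pA ¬asc = subst (λ B → rank (σ A) < rank B) (sym (σ-involutive A))
    (ℕ.≤∧≢⇒< (ℕ.≮⇒≥ ¬asc) (λ eq → P⇒σ-moves pA (rank-injective eq)))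

  length-descending≤ascending : length descending ≤ length ascending
  length-descending≤ascending =
    length-≤-by-injection σ (Unique.filter⁺ (∁? ascending?) moved!) (λ _ _ → σ-injective) λ A∈ →
      let (A∈moved , ¬asc) = ∈-filter⁻ (∁? ascending?) A∈ in
      ∈-filter⁺ ascending? (moved-σ A∈moved) (¬ascending⇒ascending-σ (moved⇒P A∈moved) ¬asc)

  length-ascending≤descending : length ascending ≤ length descending
  length-ascending≤descending =
    length-≤-by-injection σ (Unique.filter⁺ ascending? moved!) (λ _ _ → σ-injective) λ A∈ →
      let (A∈moved , asc) = ∈-filter⁻ ascending? A∈ in
      ∈-filter⁺ (∁? ascending?) (moved-σ A∈moved) (ascending⇒¬ascending-σ asc)

  length-moved : length moved ≡ 2 * length ascending
  length-moved = begin
    length moved                           ≡⟨ length-filter-∁ ascending? moved ⟨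
    length ascending + length descending   ≡⟨ cong (length ascending +_) descending≡ascending ⟩
    length ascending + length ascending    ≡⟨ cong (length ascending +_) (ℕ.+-identityʳ _) ⟨
    2 * length ascending                   ∎
    where
    open ≡-Reasoning
    descending≡ascending : length descending ≡ length ascending
    descending≡ascending = ℕ.≤-antisym length-descending≤ascending length-ascending≤descending

Isolated : ∀ {V : Set} → Graph V → V → Set
Isolated G v = ∀ u → ¬ Adj G v u

adjacent⇒≢ : ∀ {V : Set} (H : Graph V) {u v : V} → Adj H u v → u ≢ v
adjacent⇒≢ H uv refl = Graph.irrefl H uv

endpoint-adjacent : ∀ {V : Set} (H : Graph V) {A : V} (M : List (V × V)) →
                    All (λ { (u , v) → Adj H u v }) M → A ∈ endpoints M → Σ V (Adj H A)
endpoint-adjacent H ((u , v) ∷ M) (uv ∷ _) (here refl) = v , uv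
endpoint-adjacent H ((u , v) ∷ M) (uv ∷ _) (there (here refl)) = u , Graph.sym H uv
endpoint-adjacent H (_ ∷ M) (_ ∷ edges) (there (there A∈)) = endpoint-adjacent H M edges A∈

module InvolutionMatching
  {V : Set} (H : Graph V) {L : List V} (L-unique : Unique L) (L-complete : ∀ A → A ∈ L)
  (rank : V → ℕ) (rank-injective : ∀ {A B} → rank A ≡ rank B → A ≡ B)
  (σ : V → V) (σ-involutive : ∀ A → σ (σ A) ≡ A)
  {P : Pred V 0ℓ} (P? : Decidable P)
  (adjacent⇒P : ∀ {A B} → Adj H A B → P A) (P⇒adjacent-σ : ∀ {A} → P A → Adj H A (σ A))
  where

  open InvolutionOrbits L-unique L-complete rank rank-injective σ σ-involutive P?
    (λ pA → adjacent⇒P (Graph.sym H (P⇒adjacent-σ pA)))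
    (λ pA σA≡A → adjacent⇒≢ H (P⇒adjacent-σ pA) (sym σA≡A))
    public

  matching : List (V × V)
  matching = map (λ A → A , σ A) ascending

  matching-isMatching : IsMatching H matching
  matching-isMatching = edges , Unique-resp-↭ (↭-sym (endpoints-map-graph σ ascending))
                                  (Unique.++⁺ ascending! (Unique.map⁺ σ-injective ascending!) disjoint)
    where
    ascending! : Unique ascending
    ascending! = Unique.filter⁺ ascending? moved!

    edges : All (λ { (u , v) → Adj H u v }) matching
    edges = All.map⁺ (All.tabulate λ A∈ →
      P⇒adjacent-σ (moved⇒P (proj₁ (∈-filter⁻ ascending? {xs = moved} A∈))))

    disjoint : ∀ {A} → ¬ (A ∈ ascending × A ∈ map σ ascending)
    disjoint (A∈ , σB∈) with ∈-map⁻ σ σB∈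
    ... | B , B∈ , refl = ascending⇒¬ascending-σ (proj₂ (∈-filter⁻ ascending? {xs = moved} B∈))
                                                 (proj₂ (∈-filter⁻ ascending? {xs = moved} A∈))

  matching-size-≤ : ∀ M → IsMatching H M → 2 * length M ≤ length moved
  matching-size-≤ M (edges , endpoints!) = subst (_≤ length moved) (length-endpoints M)
    (Unique-⊆⇒length-≤ endpoints! λ A∈ →
      ∈-filter⁺ P? (L-complete _) (adjacent⇒P (proj₂ (endpoint-adjacent H M edges A∈))))

  matchingNumber : IsMatchingNumber H (length ascending)
  matchingNumber = (matching , matching-isMatching , length-map _ ascending) , λ M M-matching →
    ℕ.*-cancelˡ-≤ 2 (subst (2 * length M ≤_) length-moved (matching-size-≤ M M-matching))

module _ {n : ℕ} where

  low high : Pair2 n → Fin n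
  low ((a , _) , _) = a
  high ((_ , b) , _) = b

  low<high : (A : Pair2 n) → low A Fin.< high A
  low<high (_ , a<b) = a<b

  Pair2-≡ : {A B : Pair2 n} → low A ≡ low B → high A ≡ high B → A ≡ B
  Pair2-≡ {(a , b) , a<b} {(.a , .b) , a<b′} refl refl = cong ((a , b) ,_) (Fin.<-irrelevant a<b a<b′)

  _∈₂?_ : (z : Fin n) (A : Pair2 n) → Dec (z ∈₂ A)
  z ∈₂? ((a , b) , _) = z Fin.≟ a ⊎-dec z Fin.≟ b

  low∈₂ : (A : Pair2 n) → low A ∈₂ A
  low∈₂ _ = inj₁ refl

  no-three-elements : ∀ {A : Pair2 n} {x y z} → x ∈₂ A → y ∈₂ A → z ∈₂ A → x ≢ y → x ≢ z → y ≢ z → ⊥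
  no-three-elements (inj₁ refl) (inj₁ refl) _ x≢y _ _ = x≢y refl
  no-three-elements (inj₂ refl) (inj₂ refl) _ x≢y _ _ = x≢y refl
  no-three-elements (inj₁ refl) _ (inj₁ refl) _ x≢z _ = x≢z refl
  no-three-elements (inj₂ refl) _ (inj₂ refl) _ x≢z _ = x≢z refl
  no-three-elements _ (inj₁ refl) (inj₁ refl) _ _ y≢z = y≢z refl
  no-three-elements _ (inj₂ refl) (inj₂ refl) _ _ y≢z = y≢z refl

  infix 4 _≐_,_
  _≐_,_ : Pair2 n → Fin n → Fin n → Set
  A ≐ x , y = ∀ z → z ∈₂ A ⇔ (z ≡ x ⊎ z ≡ y)

  ≐-low-high : (A : Pair2 n) → A ≐ low A , high A
  ≐-low-high _ _ = ⇔-id _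

  ≐-swap : ∀ {A : Pair2 n} {x y} → A ≐ x , y → A ≐ y , x
  ≐-swap A≐ z = mk⇔ (swap ∘ Equivalence.to (A≐ z)) (Equivalence.from (A≐ z) ∘ swap)

  ∈₂-≐ˡ : ∀ {A : Pair2 n} {x y} → A ≐ x , y → x ∈₂ A
  ∈₂-≐ˡ A≐ = Equivalence.from (A≐ _) (inj₁ refl)

  ∈₂-≐ʳ : ∀ {A : Pair2 n} {x y} → A ≐ x , y → y ∈₂ A
  ∈₂-≐ʳ A≐ = Equivalence.from (A≐ _) (inj₂ refl)

  ≐⇒≢ : ∀ {A : Pair2 n} {x y} → A ≐ x , y → x ≢ y
  ≐⇒≢ {A} A≐ refl with Equivalence.to (A≐ (low A)) (inj₁ refl) | Equivalence.to (A≐ (high A)) (inj₂ refl)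
  ... | inj₁ refl | inj₁ refl = Fin.<-irrefl refl (low<high A)
  ... | inj₁ refl | inj₂ refl = Fin.<-irrefl refl (low<high A)
  ... | inj₂ refl | inj₁ refl = Fin.<-irrefl refl (low<high A)
  ... | inj₂ refl | inj₂ refl = Fin.<-irrefl refl (low<high A)

  ≐-cases : ∀ {A : Pair2 n} {x y x′ y′} → A ≐ x , y → A ≐ x′ , y′ →
            (x ≡ x′ × y ≡ y′) ⊎ (x ≡ y′ × y ≡ x′)
  ≐-cases {A} {x} {y} A≐ A≐′
    with Equivalence.to (A≐′ x) (∈₂-≐ˡ {A} {x} {y} A≐) | Equivalence.to (A≐′ y) (∈₂-≐ʳ {A} {x} {y} A≐)
  ... | inj₁ x≡x′ | inj₂ y≡y′ = inj₁ (x≡x′ , y≡y′)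
  ... | inj₂ x≡y′ | inj₁ y≡x′ = inj₂ (x≡y′ , y≡x′)
  ... | inj₁ refl | inj₁ refl = ⊥-elim (≐⇒≢ {A} A≐ refl)
  ... | inj₂ refl | inj₂ refl = ⊥-elim (≐⇒≢ {A} A≐ refl)

  ≐-injective : ∀ {A B : Pair2 n} {x y} → A ≐ x , y → B ≐ x , y → A ≡ B
  ≐-injective {A} {B} A≐ B≐
    with ≐-cases {A} {x′ = low B} {high B} (≐-low-high A) (λ z → ⇔-sym (B≐ z) ⇔-∘ A≐ z)
  ... | inj₁ (low≡low , high≡high) = Pair2-≡ low≡low high≡high
  ... | inj₂ (refl , refl) = ⊥-elim (Fin.<-asym (low<high A) (low<high B))

  pair : (x y : Fin n) → x ≢ y → Pair2 n
  pair x y x≢y with Fin.<-cmp x y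
  ... | tri< x<y _ _ = (x , y) , x<y
  ... | tri≈ _ x≡y _ = ⊥-elim (x≢y x≡y)
  ... | tri> _ _ y<x = (y , x) , y<x

  pair-≐ : (x y : Fin n) (x≢y : x ≢ y) → pair x y x≢y ≐ x , y
  pair-≐ x y x≢y with Fin.<-cmp x y
  ... | tri< _ _ _ = λ _ → ⇔-id _
  ... | tri≈ _ x≡y _ = ⊥-elim (x≢y x≡y)
  ... | tri> _ _ y<x = ≐-swap {(y , x) , y<x} {y} {x} (λ _ → ⇔-id _)

  exchange-△ : ∀ {A B : Pair2 n} {x x′ y} → A ≐ x , y → B ≐ x′ , y → x ≢ x′ →
               ∀ z → z ∈△ A , B ⇔ (z ≡ x ⊎ z ≡ x′)
  exchange-△ {A} {B} {x} {x′} {y} A≐ B≐ x≢x′ z = mk⇔ to from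
    where
    y∈A : y ∈₂ A
    y∈A = ∈₂-≐ʳ {A} {x} A≐
    y∈B : y ∈₂ B
    y∈B = ∈₂-≐ʳ {B} {x′} B≐

    to : z ∈△ A , B → z ≡ x ⊎ z ≡ x′
    to (inj₁ (z∈A , z∉B)) = [ inj₁ , (λ { refl → ⊥-elim (z∉B y∈B) }) ]′ (Equivalence.to (A≐ z) z∈A)
    to (inj₂ (z∈B , z∉A)) = [ inj₂ , (λ { refl → ⊥-elim (z∉A y∈A) }) ]′ (Equivalence.to (B≐ z) z∈B)

    from : z ≡ x ⊎ z ≡ x′ → z ∈△ A , B
    from (inj₁ refl) = inj₁ (∈₂-≐ˡ {A} A≐ , λ z∈B → [ x≢x′ , ≐⇒≢ {A} A≐ ]′ (Equivalence.to (B≐ z) z∈B))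
    from (inj₂ refl) = inj₂ (∈₂-≐ˡ {B} B≐ , λ z∈A → [ x≢x′ ∘ sym , ≐⇒≢ {B} B≐ ]′ (Equivalence.to (A≐ z) z∈A))

  -- Then A = {u, v} misses B, so low B ∈ B ∖ A ⊆ {u, v}, contradicting u, v ∉ B.
  two-tokens-cannot-leave : ∀ {A B : Pair2 n} {u v} → (∀ z → z ∈△ A , B ⇔ (z ≡ u ⊎ z ≡ v)) → u ≢ v →
                            u ∈₂ A → ¬ u ∈₂ B → v ∈₂ A → ¬ v ∈₂ B → ⊥
  two-tokens-cannot-leave {A = A} {B = B} △≐ u≢v u∈A u∉B v∈A v∉B = case low B ∈₂? A of λ
    { (yes b∈A) → no-three-elements {A} b∈A u∈A v∈A b≢u b≢v u≢v
    ; (no b∉A) → [ b≢u , b≢v ]′ (Equivalence.to (△≐ (low B)) (inj₂ (low∈₂ B , b∉A)))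
    }
    where
    b≢u : low B ≢ _
    b≢u refl = u∉B (low∈₂ B)
    b≢v : low B ≢ _
    b≢v refl = v∉B (low∈₂ B)

suc-pair : ∀ {n} → Pair2 n → Pair2 (suc n)
suc-pair ((a , b) , a<b) = (Fin.suc a , Fin.suc b) , s≤s a<b

zero-pair : ∀ {n} → Fin n → Pair2 (suc n)
zero-pair j = (Fin.zero , Fin.suc j) , s≤s z≤n

pairs : (n : ℕ) → List (Pair2 n)
pairs zero = []
pairs (suc n) = map zero-pair (allFin n) ++ map suc-pair (pairs n)

pairs-complete : ∀ {n} (A : Pair2 n) → A ∈ pairs n
pairs-complete {suc n} ((Fin.zero , Fin.suc j) , s≤s z≤n) = ∈-++⁺ˡ (∈-map⁺ zero-pair (∈-allFin j))
pairs-complete {suc n} ((Fin.suc a , Fin.suc b) , s≤s a<b) =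
  ∈-++⁺ʳ (map zero-pair (allFin n)) (∈-map⁺ suc-pair (pairs-complete ((a , b) , a<b)))

pairs-unique : ∀ n → Unique (pairs n)
pairs-unique zero = []
pairs-unique (suc n) = Unique.++⁺ (Unique.map⁺ zero-pair-injective (Unique.allFin⁺ n))
                                  (Unique.map⁺ suc-pair-injective (pairs-unique n)) disjoint
  where
  zero-pair-injective : ∀ {i j : Fin n} → zero-pair i ≡ zero-pair j → i ≡ j
  zero-pair-injective refl = refl

  suc-pair-injective : ∀ {A B : Pair2 n} → suc-pair A ≡ suc-pair B → A ≡ B
  suc-pair-injective eq = Pair2-≡ (Fin.suc-injective (cong low eq)) (Fin.suc-injective (cong high eq))

  disjoint : ∀ {A} → ¬ (A ∈ map zero-pair (allFin n) × A ∈ map suc-pair (pairs n))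
  disjoint (A∈₀ , A∈₁) with ∈-map⁻ zero-pair A∈₀ | ∈-map⁻ suc-pair A∈₁
  ... | _ , _ , refl | ((_ , _) , _) , _ , ()

length-pairs : ∀ n → length (pairs n) ≡ n C 2
length-pairs zero = refl
length-pairs (suc n) = begin
  length (map zero-pair (allFin n) ++ map suc-pair (pairs n))           ≡⟨ length-++ (map zero-pair (allFin n)) ⟩
  length (map zero-pair (allFin n)) + length (map suc-pair (pairs n))   ≡⟨ cong₂ _+_ length-zero-pairs length-suc-pairs ⟩
  n + n C 2                                                             ≡⟨ cong (_+ n C 2) (nC1≡n n) ⟨
  n C 1 + n C 2                                                         ≡⟨ nCk+nC[k+1]≡[n+1]C[k+1] n 1 ⟩
  suc n C 2                                                             ∎
  where
  open ≡-Reasoning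
  length-zero-pairs : length (map zero-pair (allFin n)) ≡ n
  length-zero-pairs = trans (length-map zero-pair (allFin n)) (length-tabulate id)
  length-suc-pairs : length (map suc-pair (pairs n)) ≡ n C 2
  length-suc-pairs = trans (length-map suc-pair (pairs n)) (length-pairs n)

-- The mate of an unmatched vertex is itself.
record Mating {n : ℕ} (G : Graph (Fin n)) : Set where
  field
    mate : Fin n → Fin n
    mate-involutive : ∀ x → mate (mate x) ≡ x
    adjacent⇒mate : ∀ {x y} → Adj G x y → y ≡ mate x
    mate-adjacent : ∀ {x} → mate x ≢ x → Adj G x (mate x)
    unmatched-unique : ∀ {x y} → mate x ≡ x → mate y ≡ y → x ≡ y

module _ {n : ℕ} {G : Graph (Fin n)} (neighbour-or-isolated : ∀ v → HasUniqueNeighbour G v ⊎ Isolated G v) where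

  neighbour : Fin n → Fin n
  neighbour v with neighbour-or-isolated v
  ... | inj₁ (u , _) = u
  ... | inj₂ _ = v

  neighbour-cases : ∀ v → (Adj G v (neighbour v) × ∀ u → Adj G v u → u ≡ neighbour v) ⊎
                          (neighbour v ≡ v × Isolated G v)
  neighbour-cases v with neighbour-or-isolated v
  ... | inj₁ (u , vu , unique) = inj₁ (vu , unique)
  ... | inj₂ isolated = inj₂ (refl , isolated)

  adjacent⇒neighbour : ∀ {x y} → Adj G x y → y ≡ neighbour x
  adjacent⇒neighbour {x} {y} xy with neighbour-cases x
  ... | inj₁ (_ , unique) = unique y xy
  ... | inj₂ (_ , isolated) = ⊥-elim (isolated y xy)

  neighbour-adjacent : ∀ {x} → neighbour x ≢ x → Adj G x (neighbour x)
  neighbour-adjacent {x} moved with neighbour-cases x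
  ... | inj₁ (x~nx , _) = x~nx
  ... | inj₂ (fixed , _) = ⊥-elim (moved fixed)

  neighbour-involutive : ∀ x → neighbour (neighbour x) ≡ x
  neighbour-involutive x with neighbour-cases x
  ... | inj₁ (x~nx , _) = sym (adjacent⇒neighbour (Graph.sym G x~nx))
  ... | inj₂ (fixed , _) = trans (cong neighbour fixed) fixed

  fixed⇒isolated : ∀ {x} → neighbour x ≡ x → Isolated G x
  fixed⇒isolated {x} fixed with neighbour-cases x
  ... | inj₁ (x~nx , _) = ⊥-elim (Graph.irrefl G (subst (Adj G x) fixed x~nx))
  ... | inj₂ (_ , isolated) = isolated

  mating : (∀ {v w} → Isolated G v → Isolated G w → v ≡ w) → Mating G
  mating isolated-unique = record
    { mate = neighbour
    ; mate-involutive = neighbour-involutive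
    ; adjacent⇒mate = adjacent⇒neighbour
    ; mate-adjacent = neighbour-adjacent
    ; unmatched-unique = λ fixed-x fixed-y → isolated-unique (fixed⇒isolated fixed-x) (fixed⇒isolated fixed-y)
    }

module TokenGraphOfMating {n : ℕ} {G : Graph (Fin n)} (𝕄 : Mating G) where
  open Mating 𝕄

  mate-injective : ∀ {x y} → mate x ≡ mate y → x ≡ y
  mate-injective {x} {y} eq = trans (sym (mate-involutive x)) (trans (cong mate eq) (mate-involutive y))

  IsEdge : Pred (Pair2 n) 0ℓ
  IsEdge A = high A ≡ mate (low A)

  isEdge? : Decidable IsEdge
  isEdge? A = high A Fin.≟ mate (low A)

  IsEdge-≐ : ∀ {A : Pair2 n} {x y} → IsEdge A → A ≐ x , y → y ≡ mate x
  IsEdge-≐ {A} {x} {y} edge A≐ with ≐-cases {A = A} {x′ = x} {y′ = y} (≐-low-high A) A≐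
  ... | inj₁ (refl , refl) = edge
  ... | inj₂ (refl , refl) = sym (trans (cong mate edge) (mate-involutive (low A)))

  edge-mate-closed : ∀ {A : Pair2 n} {z} → IsEdge A → z ∈₂ A → mate z ∈₂ A
  edge-mate-closed edge (inj₁ refl) = inj₂ (sym edge)
  edge-mate-closed {A} edge (inj₂ refl) = inj₁ (trans (cong mate edge) (mate-involutive (low A)))

  edge-isolated : ∀ {A B : Pair2 n} → TokenAdj G A B → ¬ IsEdge A
  edge-isolated {A} {B} (u , v , u~v , △≐) edge
    with Equivalence.from (△≐ u) (inj₁ refl) | Equivalence.from (△≐ v) (inj₂ refl)
  ... | inj₁ (u∈A , u∉B) | inj₁ (v∈A , v∉B) =
    two-tokens-cannot-leave {A = A} {B = B} △≐ (adjacent⇒≢ G u~v) u∈A u∉B v∈A v∉B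
  ... | inj₂ (u∈B , u∉A) | inj₂ (v∈B , v∉A) =
    two-tokens-cannot-leave {A = B} {B = A} (λ z → △≐ z ⇔-∘ mk⇔ swap swap) (adjacent⇒≢ G u~v)
                            u∈B u∉A v∈B v∉A
  ... | inj₁ (u∈A , _) | inj₂ (_ , v∉A) =
    v∉A (subst (_∈₂ A) (sym (adjacent⇒mate u~v)) (edge-mate-closed {A} edge u∈A))
  ... | inj₂ (_ , u∉A) | inj₁ (v∈A , _) =
    u∉A (subst (_∈₂ A) (sym (adjacent⇒mate (Graph.sym G u~v))) (edge-mate-closed {A} edge v∈A))

  -- Unmatched vertices get the largest key, so the move σ below only ever moves a matched token.
  key : Fin n → ℕ
  key x with mate x Fin.≟ x
  ... | yes _ = n
  ... | no _ = toℕ x ⊓ toℕ (mate x)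

  key-cases : ∀ x → (mate x ≡ x × key x ≡ n) ⊎ (mate x ≢ x × key x ≡ toℕ x ⊓ toℕ (mate x))
  key-cases x with mate x Fin.≟ x
  ... | yes fixed = inj₁ (fixed , refl)
  ... | no moved = inj₂ (moved , refl)

  matched-key<n : ∀ x → toℕ x ⊓ toℕ (mate x) < n
  matched-key<n x = ℕ.≤-<-trans (ℕ.m⊓n≤m (toℕ x) (toℕ (mate x))) (Fin.toℕ<n x)

  key≤n : ∀ x → key x ≤ n
  key≤n x with key-cases x
  ... | inj₁ (_ , k≡n) = ℕ.≤-reflexive k≡n
  ... | inj₂ (_ , k≡) = subst (_≤ n) (sym k≡) (ℕ.<⇒≤ (matched-key<n x))

  key<⇒matched : ∀ {x y} → key x < key y → mate x ≢ x
  key<⇒matched {x} {y} k< fixed with key-cases x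
  ... | inj₁ (_ , k≡n) = ℕ.<⇒≱ k< (subst (key y ≤_) (sym k≡n) (key≤n y))
  ... | inj₂ (moved , _) = moved fixed

  key-mate : ∀ x → key (mate x) ≡ key x
  key-mate x with key-cases x | key-cases (mate x)
  ... | inj₁ (_ , k≡n) | inj₁ (_ , k′≡n) = trans k′≡n (sym k≡n)
  ... | inj₁ (fixed , _) | inj₂ (moved , _) = ⊥-elim (moved (cong mate fixed))
  ... | inj₂ (moved , _) | inj₁ (fixed , _) = ⊥-elim (moved (mate-injective fixed))
  ... | inj₂ (_ , k≡) | inj₂ (_ , k′≡) = begin
    key (mate x)                         ≡⟨ k′≡ ⟩
    toℕ (mate x) ⊓ toℕ (mate (mate x))   ≡⟨ cong (λ z → toℕ (mate x) ⊓ toℕ z) (mate-involutive x) ⟩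
    toℕ (mate x) ⊓ toℕ x                 ≡⟨ ℕ.⊓-comm (toℕ (mate x)) (toℕ x) ⟩
    toℕ x ⊓ toℕ (mate x)                 ≡⟨ k≡ ⟨
    key x                                ∎
    where open ≡-Reasoning

  same-min⇒same-class : ∀ {x y} → toℕ x ⊓ toℕ (mate x) ≡ toℕ y ⊓ toℕ (mate y) → x ≡ y ⊎ x ≡ mate y
  same-min⇒same-class {x} {y} m≡m with ℕ.⊓-sel (toℕ x) (toℕ (mate x)) | ℕ.⊓-sel (toℕ y) (toℕ (mate y))
  ... | inj₁ mx≡x | inj₁ my≡y = inj₁ (Fin.toℕ-injective (trans (sym mx≡x) (trans m≡m my≡y)))
  ... | inj₁ mx≡x | inj₂ my≡my = inj₂ (Fin.toℕ-injective (trans (sym mx≡x) (trans m≡m my≡my)))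
  ... | inj₂ mx≡mx | inj₁ my≡y =
    inj₂ (trans (sym (mate-involutive x)) (cong mate (Fin.toℕ-injective (trans (sym mx≡mx) (trans m≡m my≡y)))))
  ... | inj₂ mx≡mx | inj₂ my≡my = inj₁ (mate-injective (Fin.toℕ-injective (trans (sym mx≡mx) (trans m≡m my≡my))))

  same-key⇒same-class : ∀ {x y} → key x ≡ key y → x ≡ y ⊎ x ≡ mate y
  same-key⇒same-class {x} {y} k≡k with key-cases x | key-cases y
  ... | inj₁ (fixed-x , _) | inj₁ (fixed-y , _) = inj₁ (unmatched-unique fixed-x fixed-y)
  ... | inj₁ (_ , kx≡n) | inj₂ (_ , ky≡) =
    ⊥-elim (ℕ.<-irrefl (trans (sym ky≡) (trans (sym k≡k) kx≡n)) (matched-key<n y))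
  ... | inj₂ (_ , kx≡) | inj₁ (_ , ky≡n) =
    ⊥-elim (ℕ.<-irrefl (trans (sym kx≡) (trans k≡k ky≡n)) (matched-key<n x))
  ... | inj₂ (_ , kx≡) | inj₂ (_ , ky≡) = same-min⇒same-class (trans (sym kx≡) (trans k≡k ky≡))

  mate-low≢high : ∀ {A} → ¬ IsEdge A → mate (low A) ≢ high A
  mate-low≢high ¬edge eq = ¬edge (sym eq)

  low≢mate-high : ∀ {A} → ¬ IsEdge A → low A ≢ mate (high A)
  low≢mate-high {A} ¬edge eq = ¬edge (trans (sym (mate-involutive (high A))) (cong mate (sym eq)))

  non-edge-keys-differ : ∀ {A} → ¬ IsEdge A → key (low A) ≢ key (high A)
  non-edge-keys-differ {A} ¬edge k≡k with same-key⇒same-class k≡k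
  ... | inj₁ l≡h = Fin.<-irrefl l≡h (low<high A)
  ... | inj₂ l≡mh = low≢mate-high {A} ¬edge l≡mh

  σ : Pair2 n → Pair2 n
  σ A with isEdge? A | key (low A) <? key (high A)
  ... | yes _ | _ = A
  ... | no ¬edge | yes _ = pair (mate (low A)) (high A) (mate-low≢high {A} ¬edge)
  ... | no ¬edge | no _ = pair (low A) (mate (high A)) (low≢mate-high {A} ¬edge)

  record LowerKeyMove (A B : Pair2 n) : Set where
    field
      x y : Fin n
      A≐ : A ≐ x , y
      B≐ : B ≐ mate x , y
      key< : key x < key y

  σ-edge : ∀ {A} → IsEdge A → σ A ≡ A
  σ-edge {A} edge with isEdge? A
  ... | yes _ = refl
  ... | no ¬edge = ⊥-elim (¬edge edge)

  σ-non-edge-move : ∀ {A} → ¬ IsEdge A → LowerKeyMove A (σ A)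
  σ-non-edge-move {A} ¬edge with isEdge? A | key (low A) <? key (high A)
  ... | yes edge | _ = ⊥-elim (¬edge edge)
  ... | no ¬edge′ | yes k< = record
    { x = low A ; y = high A ; A≐ = ≐-low-high A
    ; B≐ = pair-≐ (mate (low A)) (high A) (mate-low≢high {A} ¬edge′)
    ; key< = k<
    }
  ... | no ¬edge′ | no k≮ = record
    { x = high A ; y = low A ; A≐ = ≐-swap {A = A} (≐-low-high A)
    ; B≐ = ≐-swap {A = pair (low A) (mate (high A)) _}
                  (pair-≐ (low A) (mate (high A)) (low≢mate-high {A} ¬edge′))
    ; key< = ℕ.≤∧≢⇒< (ℕ.≮⇒≥ k≮) (non-edge-keys-differ {A} ¬edge′ ∘ sym)
    }

  σ-non-edge : ∀ {A} → ¬ IsEdge A → ¬ IsEdge (σ A)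
  σ-non-edge {A} ¬edge edge = ℕ.<-irrefl (cong key x≡y) key<
    where
    open LowerKeyMove (σ-non-edge-move ¬edge)
    x≡y : x ≡ y
    x≡y = trans (sym (mate-involutive x)) (sym (IsEdge-≐ {σ A} edge B≐))

  -- σ (σ A) moves a token of σ A = {x̄, y} of lower key; since key x̄ = key x < key y, it is x̄.
  σ-involutive-non-edge : ∀ {A} → ¬ IsEdge A → σ (σ A) ≡ A
  σ-involutive-non-edge {A} ¬edge with σ-non-edge-move ¬edge | σ-non-edge-move (σ-non-edge ¬edge)
  ... | move | move′ with ≐-cases {A = σ A} (LowerKeyMove.B≐ move) (LowerKeyMove.A≐ move′)
  ... | inj₁ (refl , refl) = ≐-injective {A = σ (σ A)}
    (subst (λ z → σ (σ A) ≐ z , _) (mate-involutive (LowerKeyMove.x move)) (LowerKeyMove.B≐ move′))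
    (LowerKeyMove.A≐ move)
  ... | inj₂ (refl , refl) = ⊥-elim (ℕ.<-asym (LowerKeyMove.key< move)
    (subst (key (LowerKeyMove.y move) <_) (key-mate (LowerKeyMove.x move)) (LowerKeyMove.key< move′)))

  σ-involutive : ∀ A → σ (σ A) ≡ A
  σ-involutive A = case isEdge? A of λ
    { (yes edge) → trans (cong σ (σ-edge edge)) (σ-edge edge)
    ; (no ¬edge) → σ-involutive-non-edge ¬edge
    }

  σ-adjacent : ∀ {A} → ¬ IsEdge A → TokenAdj G A (σ A)
  σ-adjacent {A} ¬edge =
    x , mate x , mate-adjacent matched , exchange-△ {A = A} {σ A} {x} {mate x} {y} A≐ B≐ (matched ∘ sym)
    where
    open LowerKeyMove (σ-non-edge-move ¬edge)
    matched : mate x ≢ x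
    matched = key<⇒matched key<

  module Tokens = InvolutionMatching (F₂ G) (pairs-unique n) pairs-complete
    (position pairs-complete) (position-injective pairs-complete) σ σ-involutive
    (∁? isEdge?) (λ {A} {B} → edge-isolated {A} {B}) σ-adjacent

  unmatched? : Decidable (λ x → mate x ≡ x)
  unmatched? x = mate x Fin.≟ x

  module Vertices = InvolutionOrbits (Unique.allFin⁺ n) ∈-allFin toℕ Fin.toℕ-injective mate mate-involutive
    (∁? unmatched?) (λ moved eq → moved (mate-injective eq)) id

  unmatched : List (Fin n)
  unmatched = filter unmatched? (allFin n)

  length-unmatched≤1 : length unmatched ≤ 1
  length-unmatched≤1 = Unique-allEqual⇒length≤1 (Unique.filter⁺ unmatched? (Unique.allFin⁺ n))
    λ x∈ y∈ → unmatched-unique (proj₂ (∈-filter⁻ unmatched? {xs = allFin n} x∈))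
                               (proj₂ (∈-filter⁻ unmatched? {xs = allFin n} y∈))

  n≡unmatched+2*ascending : n ≡ length unmatched + 2 * length Vertices.ascending
  n≡unmatched+2*ascending = begin
    n                                                  ≡⟨ length-tabulate id ⟨
    length (allFin n)                                  ≡⟨ length-filter-∁ unmatched? (allFin n) ⟨
    length unmatched + length Vertices.moved           ≡⟨ cong (length unmatched +_) Vertices.length-moved ⟩
    length unmatched + 2 * length Vertices.ascending   ∎
    where open ≡-Reasoning

  edges : List (Pair2 n)
  edges = filter isEdge? (pairs n)

  ∈-edges⇒IsEdge : ∀ {A} → A ∈ edges → IsEdge A
  ∈-edges⇒IsEdge A∈ = proj₂ (∈-filter⁻ isEdge? {xs = pairs n} A∈)

  edge⇒low-ascending : ∀ {A} → A ∈ edges → low A ∈ Vertices.ascending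
  edge⇒low-ascending {A} A∈ =
    ∈-filter⁺ Vertices.ascending? (∈-filter⁺ (∁? unmatched?) (∈-allFin (low A)) matched) low<mate
    where
    edge : IsEdge A
    edge = ∈-edges⇒IsEdge A∈
    low<mate : low A Fin.< mate (low A)
    low<mate = subst (low A Fin.<_) edge (low<high A)
    matched : mate (low A) ≢ low A
    matched eq = Fin.<-irrefl (sym (trans edge eq)) (low<high A)

  ascending⇒edge-low : ∀ {a} → a ∈ Vertices.ascending → a ∈ map low edges
  ascending⇒edge-low {a} a∈ = ∈-map⁺ low (∈-filter⁺ isEdge? (pairs-complete ((a , mate a) , a<mate)) refl)
    where
    a<mate : a Fin.< mate a
    a<mate = proj₂ (∈-filter⁻ Vertices.ascending? {xs = Vertices.moved} a∈)

  length-edges≡ascending : length edges ≡ length Vertices.ascending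
  length-edges≡ascending = ℕ.≤-antisym
    (length-≤-by-injection low (Unique.filter⁺ isEdge? (pairs-unique n)) low-injective edge⇒low-ascending)
    (subst (length Vertices.ascending ≤_) (length-map low edges)
      (Unique-⊆⇒length-≤ (Unique.filter⁺ Vertices.ascending? Vertices.moved!) ascending⇒edge-low))
    where
    low-injective : ∀ {A B} → A ∈ edges → B ∈ edges → low A ≡ low B → A ≡ B
    low-injective A∈ B∈ low≡low =
      Pair2-≡ low≡low (trans (∈-edges⇒IsEdge A∈) (trans (cong mate low≡low) (sym (∈-edges⇒IsEdge B∈))))

  length-edges : length edges ≡ n / 2
  length-edges = begin
    length edges                                             ≡⟨ length-edges≡ascending ⟩
    length Vertices.ascending                                ≡⟨ [f+2k]/2≡k _ _ length-unmatched≤1 ⟨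
    (length unmatched + 2 * length Vertices.ascending) / 2   ≡⟨ /-congˡ n≡unmatched+2*ascending ⟨
    n / 2                                                    ∎
    where open ≡-Reasoning

  length-non-edges : length Tokens.moved ≡ n C 2 ∸ n / 2
  length-non-edges = begin
    length Tokens.moved                                  ≡⟨ ℕ.m+n∸m≡n (length edges) _ ⟨
    length edges + length Tokens.moved ∸ length edges    ≡⟨ cong₂ _∸_ edges+non-edges length-edges ⟩
    n C 2 ∸ n / 2                                        ∎
    where
    open ≡-Reasoning
    edges+non-edges : length edges + length Tokens.moved ≡ n C 2
    edges+non-edges = trans (length-filter-∁ isEdge? (pairs n)) (length-pairs n)

  matchingNumber-F₂ : Σ ℕ λ ν → IsMatchingNumber (F₂ G) ν × 2 * ν ≡ n C 2 ∸ n / 2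
  matchingNumber-F₂ =
    length Tokens.ascending , Tokens.matchingNumber , trans (sym Tokens.length-moved) length-non-edges

module _ {n : ℕ} {G : Graph (Fin n)} where

  perfect⇒Mating : (∀ v → HasUniqueNeighbour G v) → Mating G
  perfect⇒Mating unique-neighbour = mating (inj₁ ∘ unique-neighbour) λ v-isolated _ →
    ⊥-elim (v-isolated _ (proj₁ (proj₂ (unique-neighbour _))))

  almostPerfect⇒Mating : (w : Fin n) → Isolated G w → (∀ v → v ≢ w → HasUniqueNeighbour G v) → Mating G
  almostPerfect⇒Mating w w-isolated unique-neighbour =
    mating neighbour-or-isolated λ v-isolated v′-isolated →
      trans (isolated⇒w v-isolated) (sym (isolated⇒w v′-isolated))
    where
    neighbour-or-isolated : ∀ v → HasUniqueNeighbour G v ⊎ Isolated G v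
    neighbour-or-isolated v with v Fin.≟ w
    ... | yes refl = inj₂ w-isolated
    ... | no v≢w = inj₁ (unique-neighbour v v≢w)

    isolated⇒w : ∀ {v} → Isolated G v → v ≡ w
    isolated⇒w {v} v-isolated with v Fin.≟ w
    ... | yes v≡w = v≡w
    ... | no v≢w = ⊥-elim (v-isolated _ (proj₁ (proj₂ (unique-neighbour v v≢w))))

lemma2p2 : (n : ℕ) → 3 ≤ n → (G : Graph (Fin n)) →
    IsPerfectMatchingGraph G ⊎ IsAlmostPerfectMatchingGraph G →
    Σ ℕ (λ ν → IsMatchingNumber (F₂ G) ν × 2 * ν ≡ (n C 2) ∸ (n / 2))
lemma2p2 n _ G (inj₁ (_ , unique-neighbour)) =
  TokenGraphOfMating.matchingNumber-F₂ (perfect⇒Mating {G = G} unique-neighbour)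
lemma2p2 n _ G (inj₂ (_ , w , w-isolated , unique-neighbour)) =
  TokenGraphOfMating.matchingNumber-F₂ (almostPerfect⇒Mating {G = G} w w-isolated unique-neighbour)
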